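{- Let $k$ be a non-archimedean local field with valuation ring $\mathcal{O}$ and uniformizer $\pi$, let $V=k^n$ with standard basis $e_1,\dots,e_n$, identify $M_n(k)=\mathrm{End}_k(V)$, and let $R=\{\mathrm{diag}(d_1,\dots,d_n):d_i\in\mathcal{O}\}$. Suppose $S$ is an $\mathcal{O}$-order in $M_n(k)$ with $S\supset\gamma R\gamma^{ -1}$ for some $\gamma\in GL_n(k)$. Then there is $\boldsymbol{\nu}\in M_n(\mathbb{Z})$ with $C(\boldsymbol{\nu})$ reduced such that $$S=\bigcap_{m\in C(\boldsymbol{\nu})\cap(\{0\}\times\mathbb{Z}^{n-1})}\mathrm{End}_{\mathcal{O}}\Big(\gamma\big(\textstyle\bigoplus_{i=1}^n\mathcal{O}\pi^{m_i}e_i\big)\Big),$$ i.e. $S$ is the intersection of the maximal orders corresponding to the vertices lying in a convex polytope of the apartment $\gamma\mathcal{A}_0$ of the affine building of $SL_n(k)$ (where $\mathcal{A}_0$ is the apartment attached to the frame $\{e_i\}$).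
   Context: An order is a subring containing $1$ which is a free $\mathcal{O}$-module of rank $n^2$. For $\boldsymbol{\nu}=(\nu_{ij})\in M_n(\mathbb{Z})$, $C(\boldsymbol{\nu})$ is the set of $x\in\mathbb{R}^n$ with $x_1=0$ and $-\nu_{ji}\le x_i-x_j\le\nu_{ij}$ for all $i,j$; it is reduced if it contains a point of $\{0\}\times\mathbb{Z}^{n-1}$ and every hyperplane $x_i-x_j=\nu_{ij}$ meets it. Vertices of the affine building of $SL_n(k)$ are homothety classes of lattices in $V$, identified with the maximal orders $\mathrm{End}_{\mathcal{O}}(L)$; the apartment attached to a basis $\{f_i\}$ consists of the classes of $\bigoplus\mathcal{O}\pi^{a_i}f_i$, $a_i\in\mathbb{Z}$. -}

module Defs where

open import Level using (Level; _⊔_) renaming (suc to lsuc)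
open import Algebra.Bundles using (CommutativeRing)
open import Data.Nat as ℕ using (ℕ; zero; suc)
open import Data.Integer as ℤ using (ℤ; +_; -[1+_])
import Data.Rational as ℚ
open import Data.Fin using (Fin; zero; suc)
open import Data.Product using (Σ; ∃; ∃-syntax; _×_; _,_)
open import Data.List using (List)
open import Data.List.Relation.Unary.All using (All)
open import Data.List.Relation.Unary.Any using (Any)
open import Relation.Nullary using (¬_)
open import Relation.Binary.PropositionalEquality using (_≡_)

data ℤ∞ : Set where
  fin : ℤ → ℤ∞
  ∞   : ℤ∞

data _≤∞_ : ℤ∞ → ℤ∞ → Set where
  fin≤fin : ∀ {a b} → a ℤ.≤ b → fin a ≤∞ fin b
  _≤∞top  : ∀ x → x ≤∞ ∞

_+∞_ : ℤ∞ → ℤ∞ → ℤ∞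
fin a +∞ fin b = fin (a ℤ.+ b)
fin _ +∞ ∞     = ∞
∞     +∞ _     = ∞

min∞ : ℤ∞ → ℤ∞ → ℤ∞
min∞ (fin a) (fin b) = fin (a ℤ.⊓ b)
min∞ (fin a) ∞       = fin a
min∞ ∞       y       = y

record NALocalField c ℓ : Set (lsuc (c ⊔ ℓ)) where
  field
    commRing : CommutativeRing c ℓ
  open CommutativeRing commRing public hiding (ring; zero)
  field
    0≉1     : ¬ (0# ≈ 1#)
    inverse : ∀ x → ¬ (x ≈ 0#) → ∃[ y ] (x * y ≈ 1#)
    v        : Carrier → ℤ∞
    v-cong   : ∀ {x y} → x ≈ y → v x ≡ v y
    v-∞⇒0    : ∀ x → v x ≡ ∞ → x ≈ 0#
    v-0⇒∞    : ∀ x → x ≈ 0# → v x ≡ ∞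
    v-mult   : ∀ x y → v (x * y) ≡ v x +∞ v y
    v-ultra  : ∀ x y → min∞ (v x) (v y) ≤∞ v (x + y)
    v-surj   : ∀ z → ∃[ x ] (v x ≡ fin z)
    complete : (s : ℕ → Carrier) →
               (∀ N → ∃[ M ] (∀ m m' → M ℕ.≤ m → M ℕ.≤ m' →
                                 fin (+ N) ≤∞ v (s m - s m'))) →
               ∃[ x ] (∀ N → ∃[ M ] (∀ m → M ℕ.≤ m →
                                 fin (+ N) ≤∞ v (x - s m)))
    residue-finite :
      ∃[ reps ] (All (λ r → fin (+ 0) ≤∞ v r) reps ×
                 (∀ x → fin (+ 0) ≤∞ v x →
                    Any (λ r → fin (+ 1) ≤∞ v (x - r)) reps))

module _ {c ℓ} (K : NALocalField c ℓ) where
  open NALocalField K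

  In𝒪 : Carrier → Set
  In𝒪 x = fin (+ 0) ≤∞ v x

  IsUniformizer : Carrier → Set
  IsUniformizer π = v π ≡ fin (+ 1)

  _^ᴺ_ : Carrier → ℕ → Carrier
  x ^ᴺ zero  = 1#
  x ^ᴺ suc k = x * (x ^ᴺ k)

  In𝒪π^ : Carrier → ℤ → Carrier → Set (c ⊔ ℓ)
  In𝒪π^ π (+ k)      x = ∃[ a ] (In𝒪 a × x ≈ (π ^ᴺ k) * a)
  In𝒪π^ π -[1+ k ]   x = Level.Lift (c ⊔ ℓ) (In𝒪 ((π ^ᴺ suc k) * x))

  Vec : ℕ → Set c
  Vec n = Fin n → Carrier

  Mat : ℕ → Set c
  Mat n = Fin n → Fin n → Carrier

  Σᶠ : ∀ {n} → (Fin n → Carrier) → Carrier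
  Σᶠ {zero}  f = 0#
  Σᶠ {suc n} f = f zero + Σᶠ (λ i → f (suc i))

  _≈ᵛ_ : ∀ {n} → Vec n → Vec n → Set ℓ
  u ≈ᵛ w = ∀ i → u i ≈ w i

  _≈ᴹ_ : ∀ {n} → Mat n → Mat n → Set ℓ
  A ≈ᴹ B = ∀ i j → A i j ≈ B i j

  _·ᴹ_ : ∀ {n} → Mat n → Mat n → Mat n
  (A ·ᴹ B) i j = Σᶠ (λ k → A i k * B k j)

  _·ᵛ_ : ∀ {n} → Mat n → Vec n → Vec n
  (A ·ᵛ u) i = Σᶠ (λ k → A i k * u k)

  _+ᴹ_ : ∀ {n} → Mat n → Mat n → Mat n
  (A +ᴹ B) i j = A i j + B i j

  -ᴹ_ : ∀ {n} → Mat n → Mat n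
  (-ᴹ A) i j = - A i j

  _•ᴹ_ : ∀ {n} → Carrier → Mat n → Mat n
  (a •ᴹ A) i j = a * A i j

  0ᴹ : ∀ {n} → Mat n
  0ᴹ i j = 0#

  diag : ∀ {n} → Vec n → Mat n
  diag d i j with Data.Fin._≟_ i j
  ... | Relation.Nullary.yes _ = d i
  ... | Relation.Nullary.no  _ = 0#

  1ᴹ : ∀ {n} → Mat n
  1ᴹ = diag (λ _ → 1#)

  lincomb : ∀ {n r} → (Fin r → Carrier) → (Fin r → Mat n) → Mat n
  lincomb cs bs i j = Σᶠ (λ t → cs t * bs t i j)

  record IsOrder {ℓS} (n : ℕ) (S : Mat n → Set ℓS) : Set (c ⊔ ℓ ⊔ ℓS) where
    field
      S-cong : ∀ {A B} → A ≈ᴹ B → S A → S B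
      S-1    : S 1ᴹ
      S-+    : ∀ {A B} → S A → S B → S (A +ᴹ B)
      S--    : ∀ {A} → S A → S (-ᴹ A)
      S-·    : ∀ {A B} → S A → S B → S (A ·ᴹ B)
      S-•    : ∀ {a A} → In𝒪 a → S A → S (a •ᴹ A)
      basis  : Fin (n ℕ.* n) → Mat n
      basis∈ : ∀ t → S (basis t)
      spans  : ∀ {A} → S A →
               ∃[ cs ] ((∀ t → In𝒪 (cs t)) × A ≈ᴹ lincomb cs basis)
      indep  : ∀ cs → (∀ t → In𝒪 (cs t)) →
               lincomb cs basis ≈ᴹ 0ᴹ → ∀ t → cs t ≈ 0#

  InLattice : ∀ {n} → Carrier → Mat n → (Fin n → ℤ) → Vec n → Set (c ⊔ ℓ)
  InLattice π γ m u =
    ∃[ w ] ((∀ i → In𝒪π^ π (m i) (w i)) × u ≈ᵛ (γ ·ᵛ w))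

  InEnd : ∀ {n} → Carrier → Mat n → (Fin n → ℤ) → Mat n → Set (c ⊔ ℓ)
  InEnd π γ m A = ∀ u → InLattice π γ m u → InLattice π γ m (A ·ᵛ u)

-- The polytope C(ν) (coordinates indexed by Fin (suc n'), x₁ = coordinate zero)

InCℤ : ∀ {n} → (Fin (suc n) → Fin (suc n) → ℤ) → (Fin (suc n) → ℤ) → Set
InCℤ ν x = (x zero ≡ + 0) ×
           (∀ i j → (ℤ.- ν j i ℤ.≤ x i ℤ.- x j) × (x i ℤ.- x j ℤ.≤ ν i j))

-- points of C(ν) (real points approximated by rational points)
InCℚ : ∀ {n} → (Fin (suc n) → Fin (suc n) → ℤ) → (Fin (suc n) → ℚ.ℚ) → Set
InCℚ ν x = (x zero ≡ ℚ.0ℚ) ×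
           (∀ i j → (ℚ.- (ν j i ℚ./ 1) ℚ.≤ x i ℚ.- x j) ×
                    (x i ℚ.- x j ℚ.≤ ν i j ℚ./ 1))

Reduced : ∀ {n} → (Fin (suc n) → Fin (suc n) → ℤ) → Set
Reduced ν = (∃[ x ] InCℤ ν x) ×
            (∀ i j → ∃[ x ] (InCℚ ν x × (x i ℚ.- x j ≡ ν i j ℚ./ 1)))

{-# OPTIONS --safe #-}

-- Conjugating by γ we may assume S contains the diagonal order R. Let ν_ij be
-- the least valuation of an (i, j)-entry of a basis element of S; it is finite
-- because S has rank n². Multiplying basis elements by the idempotents of R
-- and rescaling shows that S contains every y E_ij with v(y) ≥ ν_ij, hence
-- S = {B : v(B_ij) ≥ ν_ij}, and closure under products gives ν_ii = 0 and
-- ν_il ≤ ν_ij + ν_jl. A matrix B preserves ⊕ 𝒪 π^{m_i} e_i exactly when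
-- v(B_ik) ≥ m_i − m_k, so S lies in every End(L_m) with m ∈ C(ν); conversely
-- the columns m = (ν_kj − ν_1j)_k lie in C(ν) by the triangle inequality and
-- recover the bounds ν_ij, which gives both the reverse inclusion and the
-- reducedness of C(ν).

module Submission where

open import Defs
open import Level using (Level)
open import Data.Nat using (ℕ; suc)
open import Data.Integer using (ℤ)
open import Data.Fin using (Fin)
open import Data.Product using (∃-syntax; _×_)
open NALocalField using (Carrier)

open import Data.Nat as ℕ using (zero)
import Data.Nat.Properties as ℕP
open import Data.Integer as ℤ using (+_; -[1+_])
import Data.Integer.Properties as ℤP
open import Data.Integer.Tactic.RingSolver using (solve-∀)
import Data.Rational as ℚ
import Data.Rational.Properties as ℚP
import Data.Rational.Unnormalised as ℚᵘ
import Data.Rational.Unnormalised.Properties as ℚᵘP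
open import Data.Fin as Fin using (zero; suc; punchIn; punchOut)
import Data.Fin.Properties as FinP
open import Data.Product using (_,_; proj₁; proj₂; uncurry)
open import Data.Sum as Sum using (_⊎_; inj₁; inj₂)
open import Data.Vec.Functional using (insertAt)
open import Data.Vec.Functional.Properties using (insertAt-lookup; insertAt-punchIn)
open import Data.Empty using (⊥-elim)
open import Function using (_∘_)
open import Relation.Nullary using (¬_; Dec; yes; no; ¬?)
open import Relation.Nullary.Decidable using (decidable-stable)
open import Relation.Binary.PropositionalEquality as ≡ using (_≡_; _≢_)
open import Algebra.Bundles using (CommutativeRing)

module _ where
  open import Data.Integer using (_+_; _-_; -_; _≤_)

  i≤j+k⇒i-k≤j : ∀ {i j k} → i ≤ j + k → i - k ≤ j
  i≤j+k⇒i-k≤j {i} {j} {k} h =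
    ≡.subst (i - k ≤_) (cancel j k) (ℤP.+-monoˡ-≤ (- k) h)
    where
    cancel : ∀ j k → (j + k) - k ≡ j
    cancel = solve-∀

  i≤j+k⇒-j≤k-i : ∀ {i j k} → i ≤ j + k → - j ≤ k - i
  i≤j+k⇒-j≤k-i {i} {j} {k} h =
    ≡.subst₂ _≤_ (lhs i j) (rhs i j k) (ℤP.+-monoˡ-≤ (- j - i) h)
    where
    lhs : ∀ i j → i + (- j - i) ≡ - j
    lhs = solve-∀
    rhs : ∀ i j k → (j + k) + (- j - i) ≡ k - i
    rhs = solve-∀

  i-j+j≡i : ∀ i j → (i - j) + j ≡ i
  i-j+j≡i = solve-∀

  [i-k]-[j-k]≡i-j : ∀ i j k → (i - k) - (j - k) ≡ i - j
  [i-k]-[j-k]≡i-j = solve-∀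

module _ where
  open ℚ using (_/_)

  private
    toℚᵘ-/1 : ∀ i → ℚ.toℚᵘ (i / 1) ℚᵘ.≃ ℚᵘ.mkℚᵘ i 0
    toℚᵘ-/1 i = ℚP.toℚᵘ-fromℚᵘ (ℚᵘ.mkℚᵘ i 0)

  /1-neg : ∀ i → ℚ.- (i / 1) ≡ (ℤ.- i) / 1
  /1-neg i = ℚP.toℚᵘ-injective (ℚᵘP.≃-trans (ℚP.toℚᵘ-homo‿- (i / 1))
    (ℚᵘP.≃-trans (ℚᵘP.-‿cong (toℚᵘ-/1 i)) (ℚᵘP.≃-sym (toℚᵘ-/1 (ℤ.- i)))))

  /1-sub : ∀ i j → (i / 1) ℚ.- (j / 1) ≡ (i ℤ.- j) / 1
  /1-sub i j = ℚP.toℚᵘ-injective (ℚᵘP.≃-trans (ℚP.toℚᵘ-homo-+ (i / 1) (ℚ.- (j / 1)))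
    (ℚᵘP.≃-trans (ℚᵘP.+-cong (toℚᵘ-/1 i) (ℚᵘP.≃-trans (ℚP.toℚᵘ-homo‿- (j / 1)) (ℚᵘP.-‿cong (toℚᵘ-/1 j))))
      (ℚᵘP.≃-trans (ℚᵘ.*≡* (cross i j)) (ℚᵘP.≃-sym (toℚᵘ-/1 (i ℤ.- j))))))
    where
    cross : ∀ i j → (i ℤ.* + 1 ℤ.+ ℤ.- j ℤ.* + 1) ℤ.* + 1 ≡ (i ℤ.- j) ℤ.* (+ 1 ℤ.* + 1)
    cross = solve-∀

  /1-mono-≤ : ∀ {i j} → i ℤ.≤ j → (i / 1) ℚ.≤ (j / 1)
  /1-mono-≤ {i} {j} h = ℚP.toℚᵘ-cancel-≤ (ℚᵘP.≤-respʳ-≃ (ℚᵘP.≃-sym (toℚᵘ-/1 j))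
    (ℚᵘP.≤-respˡ-≃ (ℚᵘP.≃-sym (toℚᵘ-/1 i)) (ℚᵘ.*≤* (ℤP.*-monoʳ-≤-nonNeg (+ 1) h))))

-- The polytope of an integral quasi-metric

module QuasiMetricPolytope {n} (ν : Fin (suc n) → Fin (suc n) → ℤ)
  (ν-diagonal : ∀ i → ν i i ≡ + 0)
  (ν-triangle : ∀ i j l → ν i l ℤ.≤ ν i j ℤ.+ ν j l) where

  column : Fin (suc n) → Fin (suc n) → ℤ
  column j k = ν k j ℤ.- ν zero j

  column∈C : ∀ j → InCℤ ν (column j)
  column∈C j = ℤP.+-inverseʳ (ν zero j) , λ k l →
    ≡.subst (ℤ.- ν l k ℤ.≤_) (≡.sym (diff k l)) (i≤j+k⇒-j≤k-i (ν-triangle l k j)) ,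
    ≡.subst (ℤ._≤ ν k l) (≡.sym (diff k l)) (i≤j+k⇒i-k≤j (ν-triangle k l j))
    where
    diff : ∀ k l → column j k ℤ.- column j l ≡ ν k j ℤ.- ν l j
    diff k l = [i-k]-[j-k]≡i-j (ν k j) (ν l j) (ν zero j)

  column-diff : ∀ i j → column j i ℤ.- column j j ≡ ν i j
  column-diff i j = ≡.trans ([i-k]-[j-k]≡i-j (ν i j) (ν j j) (ν zero j))
    (≡.trans (≡.cong (λ x → ν i j ℤ.- x) (ν-diagonal j)) (ℤP.+-identityʳ (ν i j)))

  column∈Cℚ : ∀ j → InCℚ ν (λ k → column j k ℚ./ 1)
  column∈Cℚ j = ≡.cong (ℚ._/ 1) (proj₁ (column∈C j)) , λ k l →
    ≡.subst₂ ℚ._≤_ (≡.sym (/1-neg (ν l k))) (≡.sym (/1-sub (column j k) (column j l)))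
      (/1-mono-≤ (proj₁ (proj₂ (column∈C j) k l))) ,
    ≡.subst (ℚ._≤ ν k l ℚ./ 1) (≡.sym (/1-sub (column j k) (column j l)))
      (/1-mono-≤ (proj₂ (proj₂ (column∈C j) k l)))

  reduced : Reduced ν
  reduced = (column zero , column∈C zero) , λ i j →
    (λ k → column j k ℚ./ 1) , column∈Cℚ j ,
    ≡.trans (/1-sub (column j i) (column j j)) (≡.cong (ℚ._/ 1) (column-diff i j))

≤∞-refl : ∀ {a} → a ≤∞ a
≤∞-refl {fin a} = fin≤fin ℤP.≤-refl
≤∞-refl {∞}     = ∞ ≤∞top

≤∞-trans : ∀ {a b c} → a ≤∞ b → b ≤∞ c → a ≤∞ c
≤∞-trans (fin≤fin p) (fin≤fin q) = fin≤fin (ℤP.≤-trans p q)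
≤∞-trans _           (_ ≤∞top)   = _ ≤∞top

≤∞-total : ∀ a b → a ≤∞ b ⊎ b ≤∞ a
≤∞-total (fin a) (fin b) = Sum.map fin≤fin fin≤fin (ℤP.≤-total a b)
≤∞-total a       ∞       = inj₁ (a ≤∞top)
≤∞-total ∞       b       = inj₂ (b ≤∞top)

∞≤∞⇒≡∞ : ∀ {a} → ∞ ≤∞ a → a ≡ ∞
∞≤∞⇒≡∞ (_ ≤∞top) = ≡.refl

min∞-glb : ∀ {z a b} → fin z ≤∞ a → fin z ≤∞ b → fin z ≤∞ min∞ a b
min∞-glb {a = fin _} {fin _} (fin≤fin p) (fin≤fin q) = fin≤fin (ℤP.⊓-glb p q)
min∞-glb {a = fin _} {∞}     p           _           = p
min∞-glb {a = ∞}             _           q           = q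

+∞-mono-≤ : ∀ {a b x y} → fin a ≤∞ x → fin b ≤∞ y → fin (a ℤ.+ b) ≤∞ (x +∞ y)
+∞-mono-≤ (fin≤fin p) (fin≤fin q) = fin≤fin (ℤP.+-mono-≤ p q)
+∞-mono-≤ (fin≤fin _) (_ ≤∞top)   = _ ≤∞top
+∞-mono-≤ (_ ≤∞top)   _           = _ ≤∞top

argmin∞ : ∀ {r} (f : Fin (suc r) → ℤ∞) → ∃[ t ] (∀ s → f t ≤∞ f s)
argmin∞ {zero}  f = zero , λ { zero → ≤∞-refl }
argmin∞ {suc r} f with argmin∞ (f ∘ suc)
... | t , min with ≤∞-total (f zero) (f (suc t))
...   | inj₁ p = zero , λ { zero → ≤∞-refl ; (suc s) → ≤∞-trans p (min s) }
...   | inj₂ p = suc t , λ { zero → p ; (suc s) → min s }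

-- Finite sums and linear dependence

module FiniteSums {c ℓ} (R : CommutativeRing c ℓ) where

  open CommutativeRing R renaming (Carrier to Scalar) hiding (zero)
  open import Algebra.Properties.Semiring.Sum semiring public

  sum-zero : ∀ {n} {f : Fin n → Scalar} → (∀ i → f i ≈ 0#) → sum f ≈ 0#
  sum-zero {n} f≈0 = trans (sum-cong-≋ f≈0) (sum-replicate-zero n)

  sum-single : ∀ {n} (f : Fin (suc n) → Scalar) i → (∀ k → k ≢ i → f k ≈ 0#) → sum f ≈ f i
  sum-single f i f≈0 = trans (sum-remove {i = i} f)
    (trans (+-congˡ (sum-zero (λ u → f≈0 (punchIn i u) (FinP.punchInᵢ≢i i u)))) (+-identityʳ (f i)))

module LinearDependence {c ℓ} (R : CommutativeRing c ℓ) where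

  open CommutativeRing R renaming (Carrier to Scalar) hiding (zero)
  open FiniteSums R
  open import Algebra.Properties.Ring ring using (-‿distribˡ-*)
  open import Relation.Binary.Reasoning.Setoid setoid

  IsRelation : ∀ {r m} → (Fin r → Fin m → Scalar) → (Fin r → Scalar) → Set ℓ
  IsRelation {r} w d = ∀ p → ∑[ t < r ] (d t * w t p) ≈ 0#

  Nontrivial : ∀ {r} → (Fin r → Scalar) → Set ℓ
  Nontrivial d = ∃[ t ] ¬ d t ≈ 0#

  private
    IsRelation-suc : ∀ {r m} (w : Fin r → Fin (suc m) → Scalar) {d} →
                     (∀ t → w t zero ≈ 0#) →
                     IsRelation (λ t p → w t (suc p)) d → IsRelation w d
    IsRelation-suc w w₀≈0 rel zero    = sum-zero (λ t → trans (*-congˡ (w₀≈0 t)) (zeroʳ _))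
    IsRelation-suc w w₀≈0 rel (suc p) = rel p

    IsRelation-eliminate :
      ∀ {r m} (w : Fin (suc r) → Fin m → Scalar) (s : Fin (suc r))
      (l d′ : Fin r → Scalar) →
      IsRelation (λ u p → w (punchIn s u) p + l u * w s p) d′ →
      IsRelation w (insertAt d′ s (∑[ u < r ] (d′ u * l u)))
    IsRelation-eliminate {r} w s l d′ rel p = begin
      ∑[ t < suc r ] (d t * w t p)
        ≈⟨ sum-remove {i = s} (λ t → d t * w t p) ⟩
      d s * w s p + ∑[ u < r ] (d (punchIn s u) * w (punchIn s u) p)
        ≡⟨ ≡.cong₂ (λ a b → a * w s p + b) (insertAt-lookup d′ s ds)
             (sum-cong-≗ (λ u → ≡.cong (_* w (punchIn s u) p) (insertAt-punchIn d′ s ds u))) ⟩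
      ds * w s p + ∑[ u < r ] (d′ u * w (punchIn s u) p)
        ≈⟨ +-congʳ (*-distribʳ-sum (w s p) (λ u → d′ u * l u)) ⟩
      ∑[ u < r ] ((d′ u * l u) * w s p) + ∑[ u < r ] (d′ u * w (punchIn s u) p)
        ≈⟨ ∑-distrib-+ (λ u → (d′ u * l u) * w s p) (λ u → d′ u * w (punchIn s u) p) ⟨
      ∑[ u < r ] ((d′ u * l u) * w s p + d′ u * w (punchIn s u) p)
        ≈⟨ sum-cong-≋ (λ u → regroup (d′ u) (l u) (w s p) (w (punchIn s u) p)) ⟩
      ∑[ u < r ] (d′ u * (w (punchIn s u) p + l u * w s p))
        ≈⟨ rel p ⟩
      0# ∎
      where
      ds : Scalar
      ds = ∑[ u < r ] (d′ u * l u)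
      d : Fin (suc r) → Scalar
      d = insertAt d′ s ds
      regroup : ∀ a b x y → (a * b) * x + a * y ≈ a * (y + b * x)
      regroup a b x y = trans (+-comm _ _)
        (sym (trans (distribˡ a y (b * x)) (+-congˡ (sym (*-assoc a b x)))))

  module _ (0≉1 : ¬ 0# ≈ 1#) (inverse : ∀ x → ¬ x ≈ 0# → ∃[ y ] (x * y ≈ 1#))
           (_≟0 : ∀ x → Dec (x ≈ 0#)) where

    linearly-dependent : ∀ {m r} → m ℕ.< r → (w : Fin r → Fin m → Scalar) →
                         ∃[ d ] (Nontrivial d × IsRelation w d)
    linearly-dependent {zero} {suc r} _ w = (λ _ → 1#) , (zero , λ 1≈0 → 0≉1 (sym 1≈0)) , λ ()
    linearly-dependent {suc m} {suc r} (ℕ.s≤s m<r) w with FinP.any? (λ t → ¬? (w t zero ≟0))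
    ... | no noPivot =
      let d , nontrivial , rel = linearly-dependent (ℕP.m<n⇒m<1+n m<r) (λ t p → w t (suc p))
      in d , nontrivial , IsRelation-suc w {d} w₀≈0 rel
      where
      w₀≈0 : ∀ t → w t zero ≈ 0#
      w₀≈0 t = decidable-stable (w t zero ≟0) (λ w₀≉0 → noPivot (t , w₀≉0))
    ... | yes (s , ws≉0) =
      let d′ , (u , d′u≉0) , rel = linearly-dependent m<r (λ u p → w′ u (suc p))
      in insertAt d′ s _ ,
         (punchIn s u , λ du≈0 → d′u≉0 (trans (reflexive (≡.sym (insertAt-punchIn d′ s _ u))) du≈0)) ,
         IsRelation-eliminate w s l d′ (IsRelation-suc w′ {d′} w′₀≈0 rel)
      where
      ws⁻¹ : Scalar
      ws⁻¹ = proj₁ (inverse (w s zero) ws≉0)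
      ws·ws⁻¹≈1 : w s zero * ws⁻¹ ≈ 1#
      ws·ws⁻¹≈1 = proj₂ (inverse (w s zero) ws≉0)
      l : Fin r → Scalar
      l u = - (w (punchIn s u) zero * ws⁻¹)
      w′ : Fin r → Fin (suc m) → Scalar
      w′ u p = w (punchIn s u) p + l u * w s p
      w′₀≈0 : ∀ u → w′ u zero ≈ 0#
      w′₀≈0 u = begin
        a + - (a * ws⁻¹) * w s zero   ≈⟨ +-congˡ (-‿distribˡ-* (a * ws⁻¹) (w s zero)) ⟨
        a + - ((a * ws⁻¹) * w s zero) ≈⟨ +-congˡ (-‿cong (*-assoc a ws⁻¹ (w s zero))) ⟩
        a + - (a * (ws⁻¹ * w s zero)) ≈⟨ +-congˡ (-‿cong (*-congˡ (trans (*-comm ws⁻¹ _) ws·ws⁻¹≈1))) ⟩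
        a + - (a * 1#)                ≈⟨ +-congˡ (-‿cong (*-identityʳ a)) ⟩
        a + - a                       ≈⟨ -‿inverseʳ a ⟩
        0#                            ∎
        where
        a : Scalar
        a = w (punchIn s u) zero

    linearly-dependent-vanishing :
      ∀ {m r} → m ℕ.< r → (w : Fin r → Fin (suc m) → Scalar) (q : Fin (suc m)) →
      (∀ t → w t q ≈ 0#) → ∃[ d ] (Nontrivial d × IsRelation w d)
    linearly-dependent-vanishing m<r w q vanish =
      let d , nontrivial , rel = linearly-dependent m<r (λ t → w t ∘ punchIn q)
      in d , nontrivial , relation d rel
      where
      relation : ∀ d → IsRelation (λ t → w t ∘ punchIn q) d → IsRelation w d
      relation d rel p with q Fin.≟ p
      ... | yes ≡.refl = sum-zero (λ t → trans (*-congˡ (vanish t)) (zeroʳ _))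
      ... | no q≢p   = ≡.subst (λ p → ∑[ t < _ ] (d t * w t p) ≈ 0#)
                               (FinP.punchIn-punchOut q≢p) (rel (punchOut q≢p))

module ValuedField {c ℓ} (K : NALocalField c ℓ) where

  open NALocalField K renaming (Carrier to 𝕂)
  open FiniteSums commRing
  open import Relation.Binary.Bundles using (Setoid)
  import Relation.Binary.Reasoning.Setoid as Reasoning
  open import Algebra.Properties.AbelianGroup ℤP.+-0-abelianGroup using (identityˡ-unique; inverseʳ-unique)
  open import Algebra.Properties.Ring (CommutativeRing.ring commRing) using (-‿distribˡ-*)

  infix 4 _≤ᵥ_
  _≤ᵥ_ : ℤ → 𝕂 → Set
  z ≤ᵥ x = fin z ≤∞ v x

  fin-injective : ∀ {a b} → fin a ≡ fin b → a ≡ b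
  fin-injective ≡.refl = ≡.refl

  v-fin⇒≉0 : ∀ {x a} → v x ≡ fin a → ¬ x ≈ 0#
  v-fin⇒≉0 {x} vx≡a x≈0 with ≡.trans (≡.sym vx≡a) (v-0⇒∞ x x≈0)
  ... | ()

  v-1 : v 1# ≡ fin (+ 0)
  v-1 with v 1# in v1≡
  ... | ∞     = ⊥-elim (0≉1 (sym (v-∞⇒0 1# v1≡)))
  ... | fin a = ≡.cong fin (identityˡ-unique a a (fin-injective a+a≡a))
    where
    open ≡.≡-Reasoning
    a+a≡a : fin (a ℤ.+ a) ≡ fin a
    a+a≡a = begin
      fin (a ℤ.+ a)   ≡⟨ ≡.cong₂ _+∞_ v1≡ v1≡ ⟨
      v 1# +∞ v 1#    ≡⟨ v-mult 1# 1# ⟨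
      v (1# * 1#)     ≡⟨ v-cong (*-identityˡ 1#) ⟩
      v 1#            ≡⟨ v1≡ ⟩
      fin a           ∎

  inverse-v : ∀ {x a} → v x ≡ fin a → ∃[ y ] (x * y ≈ 1# × v y ≡ fin (ℤ.- a))
  inverse-v {x} {a} vx≡a with inverse x (v-fin⇒≉0 vx≡a)
  ... | y , xy≈1 = y , xy≈1 , v-y
    where
    a+vy≡0 : fin a +∞ v y ≡ fin (+ 0)
    a+vy≡0 = ≡.trans (≡.cong (_+∞ v y) (≡.sym vx≡a)) (≡.trans (≡.sym (v-mult x y)) (≡.trans (v-cong xy≈1) v-1))
    v-y : v y ≡ fin (ℤ.- a)
    v-y with v y | a+vy≡0
    ... | fin b | a+b≡0 = ≡.cong fin (inverseʳ-unique a b (fin-injective a+b≡0))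
    ... | ∞     | ()

  _≟0 : ∀ x → Dec (x ≈ 0#)
  x ≟0 with v x in vx≡
  ... | ∞     = yes (v-∞⇒0 x vx≡)
  ... | fin _ = no (v-fin⇒≉0 vx≡)

  v-finite : ∀ {x} → ¬ x ≈ 0# → ∃[ a ] (v x ≡ fin a)
  v-finite {x} x≉0 with v x in vx≡
  ... | fin a = a , ≡.refl
  ... | ∞     = ⊥-elim (x≉0 (v-∞⇒0 x vx≡))

  ≤ᵥ-cong : ∀ {z x y} → x ≈ y → z ≤ᵥ x → z ≤ᵥ y
  ≤ᵥ-cong {z} x≈y = ≡.subst (fin z ≤∞_) (v-cong x≈y)

  ≤ᵥ-weaken : ∀ {a b x} → a ℤ.≤ b → b ≤ᵥ x → a ≤ᵥ x
  ≤ᵥ-weaken a≤b = ≤∞-trans (fin≤fin a≤b)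

  ≤ᵥ-exact : ∀ {x a} → v x ≡ fin a → a ≤ᵥ x
  ≤ᵥ-exact {a = a} vx≡a = ≡.subst (fin a ≤∞_) (≡.sym vx≡a) ≤∞-refl

  ≤ᵥ⇒≤ : ∀ {z x b} → z ≤ᵥ x → v x ≡ fin b → z ℤ.≤ b
  ≤ᵥ⇒≤ {z} z≤x vx≡b with ≡.subst (fin z ≤∞_) vx≡b z≤x
  ... | fin≤fin z≤b = z≤b

  ≤ᵥ-0 : ∀ {z} → z ≤ᵥ 0#
  ≤ᵥ-0 {z} = ≡.subst (fin z ≤∞_) (≡.sym (v-0⇒∞ 0# refl)) (fin z ≤∞top)

  ≤ᵥ-1 : + 0 ≤ᵥ 1#
  ≤ᵥ-1 = ≤ᵥ-exact v-1

  ≤ᵥ-+ : ∀ {z x y} → z ≤ᵥ x → z ≤ᵥ y → z ≤ᵥ x + y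
  ≤ᵥ-+ {x = x} {y} z≤x z≤y = ≤∞-trans (min∞-glb z≤x z≤y) (v-ultra x y)

  ≤ᵥ-* : ∀ {a b x y} → a ≤ᵥ x → b ≤ᵥ y → a ℤ.+ b ≤ᵥ x * y
  ≤ᵥ-* {a} {b} {x} {y} a≤x b≤y = ≡.subst (fin (a ℤ.+ b) ≤∞_) (≡.sym (v-mult x y)) (+∞-mono-≤ a≤x b≤y)

  ≤ᵥ-*-integralˡ : ∀ {z a x} → + 0 ≤ᵥ a → z ≤ᵥ x → z ≤ᵥ a * x
  ≤ᵥ-*-integralˡ {z} {a} {x} a∈𝒪 z≤x = ≡.subst (_≤ᵥ a * x) (ℤP.+-identityˡ z) (≤ᵥ-* a∈𝒪 z≤x)

  ≤ᵥ-*-cancelˡ : ∀ {z a x y} → v y ≡ fin a → z ≤ᵥ y * x → z ℤ.- a ≤ᵥ x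
  ≤ᵥ-*-cancelˡ {z} {a} {x} {y} vy≡a z≤yx with inverse-v vy≡a
  ... | y⁻¹ , yy⁻¹≈1 , vy⁻¹ =
    ≡.subst (_≤ᵥ x) (ℤP.+-comm (ℤ.- a) z) (≤ᵥ-cong y⁻¹[yx]≈x (≤ᵥ-* (≤ᵥ-exact vy⁻¹) z≤yx))
    where
    y⁻¹[yx]≈x : y⁻¹ * (y * x) ≈ x
    y⁻¹[yx]≈x = trans (sym (*-assoc y⁻¹ y x))
      (trans (*-congʳ (trans (*-comm y⁻¹ y) yy⁻¹≈1)) (*-identityˡ x))

  Σᶠ≡sum : ∀ {n} (f : Fin n → 𝕂) → Σᶠ K f ≡ sum f
  Σᶠ≡sum {zero}  f = ≡.refl
  Σᶠ≡sum {suc n} f = ≡.cong (λ s → f zero + s) (Σᶠ≡sum (f ∘ suc))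

  private
    Σ≈sum : ∀ {n} (f : Fin n → 𝕂) → Σᶠ K f ≈ sum f
    Σ≈sum f = reflexive (Σᶠ≡sum f)

  Σ-cong : ∀ {n} {f g : Fin n → 𝕂} → (∀ i → f i ≈ g i) → Σᶠ K f ≈ Σᶠ K g
  Σ-cong {f = f} {g} f≈g = trans (Σ≈sum f) (trans (sum-cong-≋ f≈g) (sym (Σ≈sum g)))

  Σ-zero : ∀ {n} {f : Fin n → 𝕂} → (∀ i → f i ≈ 0#) → Σᶠ K f ≈ 0#
  Σ-zero {f = f} f≈0 = trans (Σ≈sum f) (sum-zero f≈0)

  Σ-single : ∀ {n} (f : Fin n → 𝕂) i → (∀ k → k ≢ i → f k ≈ 0#) → Σᶠ K f ≈ f i
  Σ-single {suc n} f i f≈0 = trans (Σ≈sum f) (sum-single f i f≈0)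

  Σ-distrib-+ : ∀ {n} (f g : Fin n → 𝕂) → Σᶠ K (λ i → f i + g i) ≈ Σᶠ K f + Σᶠ K g
  Σ-distrib-+ f g = trans (Σ≈sum (λ i → f i + g i)) (trans (∑-distrib-+ f g) (sym (+-cong (Σ≈sum f) (Σ≈sum g))))

  *-distribˡ-Σ : ∀ {n} a (f : Fin n → 𝕂) → a * Σᶠ K f ≈ Σᶠ K (λ i → a * f i)
  *-distribˡ-Σ a f = trans (*-congˡ (Σ≈sum f)) (trans (*-distribˡ-sum a f) (sym (Σ≈sum (λ i → a * f i))))

  *-distribʳ-Σ : ∀ {n} a (f : Fin n → 𝕂) → Σᶠ K f * a ≈ Σᶠ K (λ i → f i * a)
  *-distribʳ-Σ a f = trans (*-congʳ (Σ≈sum f)) (trans (*-distribʳ-sum a f) (sym (Σ≈sum (λ i → f i * a))))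

  Σ-comm : ∀ {m n} (f : Fin m → Fin n → 𝕂) →
           Σᶠ K (λ i → Σᶠ K (f i)) ≈ Σᶠ K (λ j → Σᶠ K (λ i → f i j))
  Σ-comm f = trans (Σ≈sum (λ i → Σᶠ K (f i))) (trans (sum-cong-≋ (λ i → Σ≈sum (f i)))
    (trans (∑-comm f) (sym (trans (Σ≈sum (λ j → Σᶠ K (λ i → f i j)))
                                  (sum-cong-≋ (λ j → Σ≈sum (λ i → f i j)))))))

  ≤ᵥ-Σ : ∀ {z n} (f : Fin n → 𝕂) → (∀ i → z ≤ᵥ f i) → z ≤ᵥ Σᶠ K f
  ≤ᵥ-Σ {n = zero}  f z≤f = ≤ᵥ-0
  ≤ᵥ-Σ {n = suc n} f z≤f = ≤ᵥ-+ (z≤f zero) (≤ᵥ-Σ (f ∘ suc) (z≤f ∘ suc))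

  infix  4 _≈M_ _≈V_
  infixl 7 _·_ _·v_ _•_

  _≈M_ : ∀ {n} → Mat K n → Mat K n → Set ℓ
  _≈M_ = _≈ᴹ_ K

  _≈V_ : ∀ {n} → Vec K n → Vec K n → Set ℓ
  _≈V_ = _≈ᵛ_ K

  _·_ : ∀ {n} → Mat K n → Mat K n → Mat K n
  _·_ = _·ᴹ_ K

  _·v_ : ∀ {n} → Mat K n → Vec K n → Vec K n
  _·v_ = _·ᵛ_ K

  _•_ : ∀ {n} → 𝕂 → Mat K n → Mat K n
  _•_ = _•ᴹ_ K

  Matˢ : ℕ → Setoid c ℓ
  Matˢ n = record
    { Carrier = Mat K n ; _≈_ = _≈M_
    ; isEquivalence = record
      { refl = λ _ _ → refl ; sym = λ A≈B i j → sym (A≈B i j)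
      ; trans = λ A≈B B≈C i j → trans (A≈B i j) (B≈C i j) } }

  Vecˢ : ℕ → Setoid c ℓ
  Vecˢ n = record
    { Carrier = Vec K n ; _≈_ = _≈V_
    ; isEquivalence = record
      { refl = λ _ → refl ; sym = λ u≈w i → sym (u≈w i)
      ; trans = λ u≈w w≈x i → trans (u≈w i) (w≈x i) } }

  module Mˢ {n} = Setoid (Matˢ n)
  module Vˢ {n} = Setoid (Vecˢ n)

  ΣM : ∀ {n r} → (Fin r → Mat K n) → Mat K n
  ΣM F i j = Σᶠ K (λ t → F t i j)

  •-congˡ : ∀ {n} {X Y : Mat K n} a → X ≈M Y → a • X ≈M a • Y
  •-congˡ a X≈Y i j = *-congˡ (X≈Y i j)

  ΣM-cong : ∀ {n r} {F G : Fin r → Mat K n} → (∀ t → F t ≈M G t) → ΣM F ≈M ΣM G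
  ΣM-cong F≈G i j = Σ-cong (λ t → F≈G t i j)

  ·-cong : ∀ {n} {A A′ B B′ : Mat K n} → A ≈M A′ → B ≈M B′ → A · B ≈M A′ · B′
  ·-cong A≈ B≈ i j = Σ-cong (λ k → *-cong (A≈ i k) (B≈ k j))

  ·v-cong : ∀ {n} {A A′ : Mat K n} {u u′ : Vec K n} → A ≈M A′ → u ≈V u′ → A ·v u ≈V A′ ·v u′
  ·v-cong A≈ u≈ i = Σ-cong (λ k → *-cong (A≈ i k) (u≈ k))

  ·-assoc : ∀ {n} (A B C : Mat K n) → (A · B) · C ≈M A · (B · C)
  ·-assoc A B C i j = begin
    Σᶠ K (λ k → Σᶠ K (λ l → A i l * B l k) * C k j)
      ≈⟨ Σ-cong (λ k → *-distribʳ-Σ (C k j) (λ l → A i l * B l k)) ⟩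
    Σᶠ K (λ k → Σᶠ K (λ l → (A i l * B l k) * C k j))
      ≈⟨ Σ-comm (λ k l → (A i l * B l k) * C k j) ⟩
    Σᶠ K (λ l → Σᶠ K (λ k → (A i l * B l k) * C k j))
      ≈⟨ Σ-cong (λ l → Σ-cong (λ k → *-assoc (A i l) (B l k) (C k j))) ⟩
    Σᶠ K (λ l → Σᶠ K (λ k → A i l * (B l k * C k j)))
      ≈⟨ Σ-cong (λ l → *-distribˡ-Σ (A i l) (λ k → B l k * C k j)) ⟨
    Σᶠ K (λ l → A i l * Σᶠ K (λ k → B l k * C k j)) ∎
    where open Reasoning setoid

  ·v-assoc : ∀ {n} (A B : Mat K n) (u : Vec K n) → (A · B) ·v u ≈V A ·v (B ·v u)
  ·v-assoc A B u i = ·-assoc A B (λ k _ → u k) i i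

  ·-ΣMʳ : ∀ {n r} (A : Mat K n) (F : Fin r → Mat K n) → A · ΣM F ≈M ΣM (λ t → A · F t)
  ·-ΣMʳ A F i j = trans (Σ-cong (λ k → *-distribˡ-Σ (A i k) (λ t → F t k j)))
                        (Σ-comm (λ k t → A i k * F t k j))

  ·-ΣMˡ : ∀ {n r} (F : Fin r → Mat K n) (A : Mat K n) → ΣM F · A ≈M ΣM (λ t → F t · A)
  ·-ΣMˡ F A i j = trans (Σ-cong (λ k → *-distribʳ-Σ (A k j) (λ t → F t i k)))
                        (Σ-comm (λ k t → F t i k * A k j))

  ·-•ʳ : ∀ {n} (A : Mat K n) a X → A · (a • X) ≈M a • (A · X)
  ·-•ʳ A a X i j = trans (Σ-cong (λ k → x[ay]≈a[xy] (A i k) (X k j)))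
                         (sym (*-distribˡ-Σ a (λ k → A i k * X k j)))
    where
    x[ay]≈a[xy] : ∀ x y → x * (a * y) ≈ a * (x * y)
    x[ay]≈a[xy] x y = trans (sym (*-assoc x a y)) (trans (*-congʳ (*-comm x a)) (*-assoc a x y))

  ·-•ˡ : ∀ {n} a (X A : Mat K n) → (a • X) · A ≈M a • (X · A)
  ·-•ˡ a X A i j = trans (Σ-cong (λ k → *-assoc a (X i k) (A k j)))
                         (sym (*-distribˡ-Σ a (λ k → X i k * A k j)))

  ·-distribˡ-+ : ∀ {n} (A B C : Mat K n) → A · (_+ᴹ_ K B C) ≈M _+ᴹ_ K (A · B) (A · C)
  ·-distribˡ-+ A B C i j = trans (Σ-cong (λ k → distribˡ (A i k) (B k j) (C k j)))
                                 (Σ-distrib-+ (λ k → A i k * B k j) (λ k → A i k * C k j))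

  ·-distribʳ-+ : ∀ {n} (A B C : Mat K n) → (_+ᴹ_ K B C) · A ≈M _+ᴹ_ K (B · A) (C · A)
  ·-distribʳ-+ A B C i j = trans (Σ-cong (λ k → distribʳ (A k j) (B i k) (C i k)))
                                 (Σ-distrib-+ (λ k → B i k * A k j) (λ k → C i k * A k j))

  ·-zeroʳ : ∀ {n} (A : Mat K n) → A · 0ᴹ K ≈M 0ᴹ K
  ·-zeroʳ A i j = Σ-zero (λ k → zeroʳ (A i k))

  ·-zeroˡ : ∀ {n} (A : Mat K n) → 0ᴹ K · A ≈M 0ᴹ K
  ·-zeroˡ A i j = Σ-zero (λ k → zeroˡ (A k j))

  -ᴹ≈-1• : ∀ {n} (A : Mat K n) → -ᴹ_ K A ≈M (- 1#) • A
  -ᴹ≈-1• A i j = trans (-‿cong (sym (*-identityˡ (A i j)))) (-‿distribˡ-* 1# (A i j))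

  δ : ∀ {n} → Fin n → Fin n → 𝕂
  δ k i with k Fin.≟ i
  ... | yes _ = 1#
  ... | no  _ = 0#

  δ-diagonal : ∀ {n} (i : Fin n) → δ i i ≈ 1#
  δ-diagonal i with i Fin.≟ i
  ... | yes _   = refl
  ... | no  i≢i = ⊥-elim (i≢i ≡.refl)

  δ-≢ : ∀ {n} {k i : Fin n} → k ≢ i → δ k i ≈ 0#
  δ-≢ {k = k} {i} k≢i with k Fin.≟ i
  ... | yes k≡i = ⊥-elim (k≢i k≡i)
  ... | no  _   = refl

  δ-integral : ∀ {n} (k i : Fin n) → + 0 ≤ᵥ δ k i
  δ-integral k i with k Fin.≟ i
  ... | yes _ = ≤ᵥ-1
  ... | no  _ = ≤ᵥ-0

  δ-*ˡ : ∀ {n} (k i : Fin n) (f : Fin n → 𝕂) → δ k i * f k ≈ δ k i * f i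
  δ-*ˡ k i f with k Fin.≟ i
  ... | yes ≡.refl = refl
  ... | no  _      = trans (zeroˡ _) (sym (zeroˡ _))

  diag-δ : ∀ {n} (d : Vec K n) i j → diag K d i j ≈ δ i j * d i
  diag-δ d i j with i Fin.≟ j
  ... | yes _ = sym (*-identityˡ _)
  ... | no  _ = sym (zeroˡ _)

  diag-diagonal : ∀ {n} (d : Vec K n) i → diag K d i i ≈ d i
  diag-diagonal d i = trans (diag-δ d i i) (trans (*-congʳ (δ-diagonal i)) (*-identityˡ (d i)))

  diag-off : ∀ {n} (d : Vec K n) {i j} → i ≢ j → diag K d i j ≈ 0#
  diag-off d {i} {j} i≢j = trans (diag-δ d i j) (trans (*-congʳ (δ-≢ i≢j)) (zeroˡ (d i)))

  diag-·ˡ : ∀ {n} (d : Vec K n) (M : Mat K n) i j → (diag K d · M) i j ≈ d i * M i j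
  diag-·ˡ d M i j = trans (Σ-single _ i (λ k k≢i → trans (*-congʳ (diag-off d (k≢i ∘ ≡.sym))) (zeroˡ _)))
                          (*-congʳ (diag-diagonal d i))

  diag-·ʳ : ∀ {n} (d : Vec K n) (M : Mat K n) i j → (M · diag K d) i j ≈ M i j * d j
  diag-·ʳ d M i j = trans (Σ-single _ j (λ k k≢j → trans (*-congˡ (diag-off d k≢j)) (zeroʳ _)))
                          (*-congˡ (diag-diagonal d j))

  ·-identityˡ : ∀ {n} (M : Mat K n) → 1ᴹ K · M ≈M M
  ·-identityˡ M i j = trans (diag-·ˡ _ M i j) (*-identityˡ _)

  ·-identityʳ : ∀ {n} (M : Mat K n) → M · 1ᴹ K ≈M M
  ·-identityʳ M i j = trans (diag-·ʳ _ M i j) (*-identityʳ _)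

  ·v-identityˡ : ∀ {n} (u : Vec K n) → 1ᴹ K ·v u ≈V u
  ·v-identityˡ u i = ·-identityˡ (λ k _ → u k) i i

  E : ∀ {n} → 𝕂 → Fin n → Fin n → Mat K n
  E y i j k l = (δ k i * y) * δ l j

  E-cong : ∀ {n x y} (i j : Fin n) → x ≈ y → E x i j ≈M E y i j
  E-cong i j x≈y k l = *-congʳ (*-congˡ x≈y)

  E-entry : ∀ {n} y (i j : Fin n) → E y i j i j ≈ y
  E-entry y i j = trans (*-cong (*-congʳ (δ-diagonal i)) (δ-diagonal j))
                        (trans (*-identityʳ _) (*-identityˡ y))

  •-E : ∀ {n} a x (i j : Fin n) → a • E x i j ≈M E (a * x) i j
  •-E a x i j k l = trans (sym (*-assoc a _ _)) (*-congʳ (trans (sym (*-assoc a _ x))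
    (trans (*-congʳ (*-comm a _)) (*-assoc _ a x))))

  E-· : ∀ {n} x y (i j l : Fin n) → E x i j · E y j l ≈M E (x * y) i l
  E-· x y i j l p q = trans
    (Σ-single _ j (λ r r≢j → trans (*-congʳ (trans (*-congˡ (δ-≢ r≢j)) (zeroʳ _))) (zeroˡ _)))
    (begin
      ((δ p i * x) * δ j j) * ((δ j j * y) * δ q l)
        ≈⟨ *-cong (trans (*-congˡ (δ-diagonal j)) (*-identityʳ _))
                  (*-congʳ (trans (*-congʳ (δ-diagonal j)) (*-identityˡ y))) ⟩
      (δ p i * x) * (y * δ q l)
        ≈⟨ *-assoc _ y _ ⟨
      ((δ p i * x) * y) * δ q l
        ≈⟨ *-congʳ (*-assoc _ x y) ⟩
      (δ p i * (x * y)) * δ q l ∎)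
    where open Reasoning setoid

  diag-·-·-diag : ∀ {n} (X : Mat K n) i j →
                  (diag K (λ p → δ p i) · X) · diag K (λ p → δ p j) ≈M E (X i j) i j
  diag-·-·-diag X i j k l = begin
    ((diag K (λ p → δ p i) · X) · diag K (λ p → δ p j)) k l
      ≈⟨ diag-·ʳ (λ p → δ p j) (diag K (λ p → δ p i) · X) k l ⟩
    (diag K (λ p → δ p i) · X) k l * δ l j
      ≈⟨ *-congʳ (diag-·ˡ (λ p → δ p i) X k l) ⟩
    (δ k i * X k l) * δ l j
      ≈⟨ *-congʳ (δ-*ˡ k i (λ q → X q l)) ⟩
    (δ k i * X i l) * δ l j
      ≈⟨ *-assoc _ _ _ ⟩
    δ k i * (X i l * δ l j)
      ≈⟨ *-congˡ (trans (*-comm _ _) (trans (δ-*ˡ l j (X i)) (*-comm _ _))) ⟩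
    δ k i * (X i j * δ l j)
      ≈⟨ *-assoc _ _ _ ⟨
    (δ k i * X i j) * δ l j ∎
    where open Reasoning setoid

  ΣE≈ : ∀ {n} (B : Mat K n) → ΣM (λ i → ΣM (λ j → E (B i j) i j)) ≈M B
  ΣE≈ B k l = trans
    (Σ-single _ k (λ i i≢k → Σ-zero {f = λ j → E (B i j) i j k l} (λ j → trans (*-congʳ (trans (*-congʳ (δ-≢ (i≢k ∘ ≡.sym))) (zeroˡ _))) (zeroˡ _))))
    (trans (Σ-single _ l (λ j j≢l → trans (*-congˡ (δ-≢ (j≢l ∘ ≡.sym))) (zeroʳ _)))
           (E-entry (B k l) k l))

  sandwich : ∀ {n} → Mat K n → Mat K n → Mat K n → Mat K n
  sandwich P Q X = (P · X) · Q

  module _ {n} (P Q : Mat K n) where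

    sandwich-cong : ∀ {X Y} → X ≈M Y → sandwich P Q X ≈M sandwich P Q Y
    sandwich-cong X≈Y = ·-cong (·-cong Mˢ.refl X≈Y) Mˢ.refl

    sandwich-+ : ∀ X Y → sandwich P Q (_+ᴹ_ K X Y) ≈M _+ᴹ_ K (sandwich P Q X) (sandwich P Q Y)
    sandwich-+ X Y = Mˢ.trans (·-cong (·-distribˡ-+ P X Y) Mˢ.refl) (·-distribʳ-+ Q (P · X) (P · Y))

    sandwich-• : ∀ a X → sandwich P Q (a • X) ≈M a • sandwich P Q X
    sandwich-• a X = Mˢ.trans (·-cong (·-•ʳ P a X) Mˢ.refl) (·-•ˡ a (P · X) Q)

    sandwich-- : ∀ X → sandwich P Q (-ᴹ_ K X) ≈M -ᴹ_ K (sandwich P Q X)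
    sandwich-- X = Mˢ.trans (sandwich-cong (-ᴹ≈-1• X))
                     (Mˢ.trans (sandwich-• (- 1#) X) (Mˢ.sym (-ᴹ≈-1• (sandwich P Q X))))

    sandwich-ΣM : ∀ {r} (F : Fin r → Mat K n) → sandwich P Q (ΣM F) ≈M ΣM (λ t → sandwich P Q (F t))
    sandwich-ΣM F = Mˢ.trans (·-cong (·-ΣMʳ P F) Mˢ.refl) (·-ΣMˡ (λ t → P · F t) Q)

    sandwich-zero : sandwich P Q (0ᴹ K) ≈M 0ᴹ K
    sandwich-zero = Mˢ.trans (·-cong (·-zeroʳ P) Mˢ.refl) (·-zeroˡ Q)

    sandwich-· : Q · P ≈M 1ᴹ K → ∀ X Y →
                 sandwich P Q X · sandwich P Q Y ≈M sandwich P Q (X · Y)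
    sandwich-· QP≈1 X Y = begin
      ((P · X) · Q) · ((P · Y) · Q)   ≈⟨ ·-assoc (P · X) Q ((P · Y) · Q) ⟩
      (P · X) · (Q · ((P · Y) · Q))   ≈⟨ ·-cong Mˢ.refl (·-assoc Q (P · Y) Q) ⟨
      (P · X) · ((Q · (P · Y)) · Q)   ≈⟨ ·-cong Mˢ.refl (·-cong (·-assoc Q P Y) Mˢ.refl) ⟨
      (P · X) · (((Q · P) · Y) · Q)   ≈⟨ ·-cong Mˢ.refl (·-cong (·-cong QP≈1 Mˢ.refl) Mˢ.refl) ⟩
      (P · X) · ((1ᴹ K · Y) · Q)      ≈⟨ ·-cong Mˢ.refl (·-cong (·-identityˡ Y) Mˢ.refl) ⟩
      (P · X) · (Y · Q)               ≈⟨ ·-assoc (P · X) Y Q ⟨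
      ((P · X) · Y) · Q               ≈⟨ ·-cong (·-assoc P X Y) Mˢ.refl ⟩
      (P · (X · Y)) · Q               ∎
      where open Reasoning (Matˢ n)

    sandwich-1 : P · Q ≈M 1ᴹ K → sandwich P Q (1ᴹ K) ≈M 1ᴹ K
    sandwich-1 PQ≈1 = Mˢ.trans (·-cong (·-identityʳ P) Mˢ.refl) PQ≈1

    ·-sandwich : P · Q ≈M 1ᴹ K → ∀ X → P · sandwich Q P X ≈M X · P
    ·-sandwich PQ≈1 X = begin
      P · ((Q · X) · P)   ≈⟨ ·-assoc P (Q · X) P ⟨
      (P · (Q · X)) · P   ≈⟨ ·-cong (·-assoc P Q X) Mˢ.refl ⟨
      ((P · Q) · X) · P   ≈⟨ ·-cong (·-cong PQ≈1 Mˢ.refl) Mˢ.refl ⟩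
      (1ᴹ K · X) · P      ≈⟨ ·-cong (·-identityˡ X) Mˢ.refl ⟩
      X · P               ∎
      where open Reasoning (Matˢ n)

    sandwich-inverse : P · Q ≈M 1ᴹ K → ∀ X → sandwich P Q (sandwich Q P X) ≈M X
    sandwich-inverse PQ≈1 X = begin
      (P · sandwich Q P X) · Q   ≈⟨ ·-cong (·-sandwich PQ≈1 X) Mˢ.refl ⟩
      (X · P) · Q                ≈⟨ ·-assoc X P Q ⟩
      X · (P · Q)                ≈⟨ ·-cong Mˢ.refl PQ≈1 ⟩
      X · 1ᴹ K                   ≈⟨ ·-identityʳ X ⟩
      X                          ∎
      where open Reasoning (Matˢ n)

  sandwich-lincomb : ∀ {n r} (P Q : Mat K n) (cs : Fin r → 𝕂) (bs : Fin r → Mat K n) →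
    sandwich P Q (lincomb K cs bs) ≈M lincomb K cs (λ t → sandwich P Q (bs t))
  sandwich-lincomb P Q cs bs =
    Mˢ.trans (sandwich-ΣM P Q (λ t → cs t • bs t)) (ΣM-cong (λ t → sandwich-• P Q (cs t) (bs t)))

  -- Lattices and their endomorphisms

  module Lattices (π : 𝕂) (π-uniformizer : IsUniformizer K π) where

    v-π^ : ∀ k → v (_^ᴺ_ K π k) ≡ fin (+ k)
    v-π^ zero    = v-1
    v-π^ (suc k) = ≡.trans (v-mult π _) (≡.cong₂ _+∞_ π-uniformizer (v-π^ k))

    In𝒪π^⇒≤ᵥ : ∀ z x → In𝒪π^ K π z x → z ≤ᵥ x
    In𝒪π^⇒≤ᵥ (+ k)    x (a , a∈𝒪 , x≈π^ka) =
      ≤ᵥ-cong (sym x≈π^ka) (≡.subst (_≤ᵥ (_^ᴺ_ K π k * a)) (ℤP.+-identityʳ (+ k)) (≤ᵥ-* (≤ᵥ-exact (v-π^ k)) a∈𝒪))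
    In𝒪π^⇒≤ᵥ -[1+ k ] x (Level.lift π^kx∈𝒪) = ≤ᵥ-*-cancelˡ (v-π^ (suc k)) π^kx∈𝒪

    ≤ᵥ⇒In𝒪π^ : ∀ z x → z ≤ᵥ x → In𝒪π^ K π z x
    ≤ᵥ⇒In𝒪π^ (+ k) x k≤x with inverse-v (v-π^ k)
    ... | y , π^ky≈1 , vy =
      y * x ,
      ≡.subst (_≤ᵥ y * x) (ℤP.+-inverseˡ (+ k)) (≤ᵥ-* (≤ᵥ-exact vy) k≤x) ,
      sym (trans (sym (*-assoc _ y x)) (trans (*-congʳ π^ky≈1) (*-identityˡ x)))
    ≤ᵥ⇒In𝒪π^ -[1+ k ] x k≤x =
      Level.lift (≡.subst (_≤ᵥ (_^ᴺ_ K π (suc k) * x)) (ℤP.+-inverseʳ (+ suc k)) (≤ᵥ-* (≤ᵥ-exact (v-π^ (suc k))) k≤x))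

    module _ {n} (γ γ⁻¹ : Mat K n) (m : Fin n → ℤ) (A : Mat K n) where

      ≤ᵥ-entries⇒InEnd : γ · γ⁻¹ ≈M 1ᴹ K →
        (∀ i k → m i ℤ.- m k ≤ᵥ sandwich γ⁻¹ γ A i k) → InEnd K π γ m A
      ≤ᵥ-entries⇒InEnd γγ⁻¹≈1 bounds u (w , w∈ , u≈γw) = sandwich γ⁻¹ γ A ·v w , Bw∈ , Au≈γBw
        where
        Bw∈ : ∀ i → In𝒪π^ K π (m i) ((sandwich γ⁻¹ γ A ·v w) i)
        Bw∈ i = ≤ᵥ⇒In𝒪π^ (m i) _ (≤ᵥ-Σ _ (λ k →
          ≡.subst (_≤ᵥ _) (i-j+j≡i (m i) (m k)) (≤ᵥ-* (bounds i k) (In𝒪π^⇒≤ᵥ (m k) (w k) (w∈ k)))))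
        Au≈γBw : A ·v u ≈V γ ·v (sandwich γ⁻¹ γ A ·v w)
        Au≈γBw = begin
          A ·v u                          ≈⟨ ·v-cong Mˢ.refl u≈γw ⟩
          A ·v (γ ·v w)                   ≈⟨ ·v-assoc A γ w ⟨
          (A · γ) ·v w                    ≈⟨ ·v-cong (·-sandwich γ γ⁻¹ γγ⁻¹≈1 A) Vˢ.refl ⟨
          (γ · sandwich γ⁻¹ γ A) ·v w     ≈⟨ ·v-assoc γ (sandwich γ⁻¹ γ A) w ⟩
          γ ·v (sandwich γ⁻¹ γ A ·v w)    ∎
          where open Reasoning (Vecˢ n)

      -- Apply A to the lattice vector e · e_j, where v(e) = m_j.
      InEnd⇒≤ᵥ-entries : γ⁻¹ · γ ≈M 1ᴹ K → InEnd K π γ m A →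
        ∀ i j → m i ℤ.- m j ≤ᵥ sandwich γ⁻¹ γ A i j
      InEnd⇒≤ᵥ-entries γ⁻¹γ≈1 A-stable i j =
        let e , ve≡mj = v-surj (m j)
            w′ , w′∈ , Aγw≈γw′ = A-stable (γ ·v w e) (w e , w∈ ve≡mj , Vˢ.refl)
        in ≤ᵥ-*-cancelˡ ve≡mj (≤ᵥ-cong (Bw≈ e w′ Aγw≈γw′) (In𝒪π^⇒≤ᵥ (m i) (w′ i) (w′∈ i)))
        where
        B : Mat K n
        B = sandwich γ⁻¹ γ A
        w : 𝕂 → Vec K n
        w e k = δ k j * e
        w∈ : ∀ {e} → v e ≡ fin (m j) → ∀ k → In𝒪π^ K π (m k) (w e k)
        w∈ {e} ve≡mj k with k Fin.≟ j
        ... | yes ≡.refl = ≤ᵥ⇒In𝒪π^ (m k) _ (≤ᵥ-cong (sym (*-identityˡ e)) (≤ᵥ-exact ve≡mj))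
        ... | no  _      = ≤ᵥ⇒In𝒪π^ (m k) _ (≤ᵥ-cong (sym (zeroˡ e)) ≤ᵥ-0)
        Bw≈ : ∀ e w′ → A ·v (γ ·v w e) ≈V γ ·v w′ → w′ i ≈ e * B i j
        Bw≈ e w′ Aγw≈γw′ = begin
          w′ i                            ≈⟨ ·v-identityˡ w′ i ⟨
          (1ᴹ K ·v w′) i                  ≈⟨ ·v-cong {A = γ⁻¹ · γ} γ⁻¹γ≈1 Vˢ.refl i ⟨
          ((γ⁻¹ · γ) ·v w′) i             ≈⟨ ·v-assoc γ⁻¹ γ w′ i ⟩
          (γ⁻¹ ·v (γ ·v w′)) i            ≈⟨ ·v-cong {A = γ⁻¹} Mˢ.refl Aγw≈γw′ i ⟨
          (γ⁻¹ ·v (A ·v (γ ·v w e))) i    ≈⟨ ·v-assoc γ⁻¹ A (γ ·v w e) i ⟨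
          ((γ⁻¹ · A) ·v (γ ·v w e)) i     ≈⟨ ·v-assoc (γ⁻¹ · A) γ (w e) i ⟨
          (B ·v w e) i                    ≈⟨ Σ-single _ j (λ k k≢j → trans (*-congˡ (trans (*-congʳ (δ-≢ k≢j)) (zeroˡ e))) (zeroʳ _)) ⟩
          B i j * (δ j j * e)             ≈⟨ *-congˡ (trans (*-congʳ (δ-diagonal j)) (*-identityˡ e)) ⟩
          B i j * e                       ≈⟨ *-comm (B i j) e ⟩
          e * B i j                       ∎
          where open Reasoning setoid

  -- Orders

  open LinearDependence commRing using (Nontrivial; linearly-dependent-vanishing)

  -- Reading a matrix as a vector of length N², N² matrices vanishing at a
  -- common position live in a space of dimension N² − 1.
  vanishing-matrices-dependent : ∀ {n} (Ms : Fin (suc n ℕ.* suc n) → Mat K (suc n)) i j →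
    (∀ t → Ms t i j ≈ 0#) → ∃[ d ] (Nontrivial d × lincomb K d Ms ≈M 0ᴹ K)
  vanishing-matrices-dependent {n} Ms i j Ms≈0 =
    let d , nontrivial , rel = linearly-dependent-vanishing 0≉1 inverse _≟0 (ℕP.n<1+n _)
                                 flat (Fin.combine i j) (λ t → trans (reflexive (flat-combine t i j)) (Ms≈0 t))
    in d , nontrivial , λ k l → trans (reflexive (Σ≡flat d k l)) (rel (Fin.combine k l))
    where
    flat : Fin (suc n ℕ.* suc n) → Fin (suc n ℕ.* suc n) → 𝕂
    flat t q = uncurry (Ms t) (Fin.remQuot (suc n) q)
    flat-combine : ∀ t k l → flat t (Fin.combine k l) ≡ Ms t k l
    flat-combine t k l = ≡.cong (uncurry (Ms t)) (FinP.remQuot-combine k l)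
    Σ≡flat : ∀ d k l → Σᶠ K (λ t → d t * Ms t k l) ≡ sum (λ t → d t * flat t (Fin.combine k l))
    Σ≡flat d k l = ≡.trans (Σᶠ≡sum (λ t → d t * Ms t k l))
      (sum-cong-≗ (λ t → ≡.cong (d t *_) (≡.sym (flat-combine t k l))))

  -- Divide by a coefficient of least valuation.
  integral-rescaling : ∀ {r} (d : Fin (suc r) → 𝕂) → Nontrivial d →
    ∃[ e ] ((∀ t → + 0 ≤ᵥ d t * e) × ∃[ t ] (d t * e ≈ 1#))
  integral-rescaling d (t₀ , dt₀≉0) with argmin∞ (v ∘ d)
  ... | t₁ , minimal with v-finite dt₁≉0
    where
    dt₁≉0 : ¬ d t₁ ≈ 0#
    dt₁≉0 dt₁≈0 = dt₀≉0 (v-∞⇒0 (d t₀) (∞≤∞⇒≡∞ (≡.subst (_≤∞ v (d t₀)) (v-0⇒∞ _ dt₁≈0) (minimal t₀))))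
  ... | z , vdt₁≡z with inverse-v vdt₁≡z
  ... | e , dt₁e≈1 , ve≡-z = e , integral , t₁ , dt₁e≈1
    where
    integral : ∀ t → + 0 ≤ᵥ d t * e
    integral t = ≡.subst (_≤ᵥ d t * e) (ℤP.+-inverseʳ z)
      (≤ᵥ-* (≡.subst (_≤∞ v (d t)) vdt₁≡z (minimal t)) (≤ᵥ-exact ve≡-z))

  module OrderProperties {ℓS n} {S : Mat K (suc n) → Set ℓS} (O : IsOrder K (suc n) S) where
    open IsOrder O

    S-0 : S (0ᴹ K)
    S-0 = S-cong (λ i j → -‿inverseʳ (1ᴹ K i j)) (S-+ S-1 (S-- S-1))

    S-ΣM : ∀ {r} (F : Fin r → Mat K (suc n)) → (∀ t → S (F t)) → S (ΣM F)
    S-ΣM {zero}  F F∈ = S-0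
    S-ΣM {suc r} F F∈ = S-+ (F∈ zero) (S-ΣM (F ∘ suc) (F∈ ∘ suc))

    -- Otherwise the N² independent basis elements would be dependent.
    basis-entry-nonzero : ∀ i j → ¬ (∀ t → basis t i j ≈ 0#)
    basis-entry-nonzero i j basis≈0 with vanishing-matrices-dependent basis i j basis≈0
    ... | d , nontrivial , rel with integral-rescaling d nontrivial
    ... | e , integral , t , dte≈1 =
      0≉1 (trans (sym (indep (λ t → d t * e) integral rel′ t)) dte≈1)
      where
      rel′ : lincomb K (λ t → d t * e) basis ≈M 0ᴹ K
      rel′ k l = trans (Σ-cong (λ t → trans (*-congʳ (*-comm (d t) e)) (*-assoc e (d t) (basis t k l))))
        (trans (sym (*-distribˡ-Σ e (λ t → d t * basis t k l))) (trans (*-congˡ (rel k l)) (zeroʳ e)))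

  IsOrder-conjugate : ∀ {ℓS n} {S : Mat K n → Set ℓS} (P Q : Mat K n) →
    P · Q ≈M 1ᴹ K → Q · P ≈M 1ᴹ K → IsOrder K n S → IsOrder K n (λ B → S (sandwich P Q B))
  IsOrder-conjugate {S = S} P Q PQ≈1 QP≈1 O = record
    { S-cong = λ A≈B → S-cong (sandwich-cong P Q A≈B)
    ; S-1    = S-cong (Mˢ.sym (sandwich-1 P Q PQ≈1)) S-1
    ; S-+    = λ A∈ B∈ → S-cong (Mˢ.sym (sandwich-+ P Q _ _)) (S-+ A∈ B∈)
    ; S--    = λ A∈ → S-cong (Mˢ.sym (sandwich-- P Q _)) (S-- A∈)
    ; S-·    = λ A∈ B∈ → S-cong (sandwich-· P Q QP≈1 _ _) (S-· A∈ B∈)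
    ; S-•    = λ a∈𝒪 A∈ → S-cong (Mˢ.sym (sandwich-• P Q _ _)) (S-• a∈𝒪 A∈)
    ; basis  = basis′
    ; basis∈ = λ t → S-cong (Mˢ.sym (sandwich-inverse P Q PQ≈1 (basis t))) (basis∈ t)
    ; spans  = spans′
    ; indep  = λ cs cs∈𝒪 rel → indep cs cs∈𝒪 (Mˢ.trans (Mˢ.sym (lincomb-basis cs))
                 (Mˢ.trans (sandwich-cong P Q rel) (sandwich-zero P Q)))
    }
    where
    open IsOrder O
    basis′ : Fin _ → Mat K _
    basis′ t = sandwich Q P (basis t)
    lincomb-basis : ∀ cs → sandwich P Q (lincomb K cs basis′) ≈M lincomb K cs basis
    lincomb-basis cs = Mˢ.trans (sandwich-lincomb P Q cs basis′)
      (ΣM-cong (λ t → •-congˡ (cs t) (sandwich-inverse P Q PQ≈1 (basis t))))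
    spans′ : ∀ {A} → S (sandwich P Q A) → ∃[ cs ] ((∀ t → In𝒪 K (cs t)) × A ≈M lincomb K cs basis′)
    spans′ {A} A∈ with spans A∈
    ... | cs , cs∈𝒪 , PAQ≈ = cs , cs∈𝒪 , Mˢ.trans (Mˢ.sym (sandwich-inverse Q P QP≈1 A))
      (Mˢ.trans (sandwich-cong Q P PAQ≈) (sandwich-lincomb Q P cs basis))

  module DiagonalOrder {ℓS n} {S : Mat K (suc n) → Set ℓS} (O : IsOrder K (suc n) S)
    (diagonal⊆S : ∀ d → (∀ i → + 0 ≤ᵥ d i) → S (diag K d)) where

    open IsOrder O
    open OrderProperties O

    minIndex : Fin (suc n) → Fin (suc n) → Fin (suc n ℕ.* suc n)
    minIndex i j = proj₁ (argmin∞ (λ t → v (basis t i j)))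

    minEntry : Fin (suc n) → Fin (suc n) → 𝕂
    minEntry i j = basis (minIndex i j) i j

    minEntry-minimal : ∀ i j t → v (minEntry i j) ≤∞ v (basis t i j)
    minEntry-minimal i j = proj₂ (argmin∞ (λ t → v (basis t i j)))

    minEntry-finite : ∀ i j → ∃[ z ] (v (minEntry i j) ≡ fin z)
    minEntry-finite i j = v-finite λ minEntry≈0 → basis-entry-nonzero i j λ t →
      v-∞⇒0 _ (∞≤∞⇒≡∞ (≡.subst (_≤∞ v (basis t i j)) (v-0⇒∞ _ minEntry≈0) (minEntry-minimal i j t)))

    ν : Fin (suc n) → Fin (suc n) → ℤ
    ν i j = proj₁ (minEntry-finite i j)

    v-minEntry : ∀ i j → v (minEntry i j) ≡ fin (ν i j)
    v-minEntry i j = proj₂ (minEntry-finite i j)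

    ν≤ᵥbasis : ∀ i j t → ν i j ≤ᵥ basis t i j
    ν≤ᵥbasis i j t = ≡.subst (_≤∞ v (basis t i j)) (v-minEntry i j) (minEntry-minimal i j t)

    ∈⇒ν≤ᵥ : ∀ {B} → S B → ∀ i j → ν i j ≤ᵥ B i j
    ∈⇒ν≤ᵥ B∈ i j =
      let cs , cs∈𝒪 , B≈ = spans B∈
      in ≤ᵥ-cong (sym (B≈ i j))
           (≤ᵥ-Σ (λ t → cs t * basis t i j) λ t → ≤ᵥ-*-integralˡ (cs∈𝒪 t) (ν≤ᵥbasis i j t))

    E-minEntry∈ : ∀ i j → S (E (minEntry i j) i j)
    E-minEntry∈ i j = S-cong (diag-·-·-diag (basis (minIndex i j)) i j)
      (S-· (S-· (diagonal⊆S _ (λ p → δ-integral p i)) (basis∈ (minIndex i j)))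
           (diagonal⊆S _ (λ p → δ-integral p j)))

    E∈ : ∀ {y} i j → ν i j ≤ᵥ y → S (E y i j)
    E∈ {y} i j ν≤y =
      let x⁻¹ , xx⁻¹≈1 , vx⁻¹ = inverse-v (v-minEntry i j)
      in S-cong (Mˢ.trans (•-E (y * x⁻¹) _ i j) (E-cong i j (yx⁻¹x≈y x⁻¹ xx⁻¹≈1)))
           (S-• (≡.subst (_≤ᵥ y * x⁻¹) (ℤP.+-inverseʳ (ν i j)) (≤ᵥ-* ν≤y (≤ᵥ-exact vx⁻¹)))
                (E-minEntry∈ i j))
      where
      yx⁻¹x≈y : ∀ x⁻¹ → minEntry i j * x⁻¹ ≈ 1# → (y * x⁻¹) * minEntry i j ≈ y
      yx⁻¹x≈y x⁻¹ xx⁻¹≈1 =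
        trans (*-assoc y x⁻¹ _) (trans (*-congˡ (trans (*-comm x⁻¹ _) xx⁻¹≈1)) (*-identityʳ y))

    ν≤ᵥ⇒∈ : ∀ {B} → (∀ i j → ν i j ≤ᵥ B i j) → S B
    ν≤ᵥ⇒∈ {B} bounds = S-cong (ΣE≈ B) (S-ΣM _ λ i → S-ΣM _ λ j → E∈ i j (bounds i j))

    ν-triangle : ∀ i j l → ν i l ℤ.≤ ν i j ℤ.+ ν j l
    ν-triangle i j l = ≤ᵥ⇒≤ (≤ᵥ-cong (E-entry _ i l) (∈⇒ν≤ᵥ product∈ i l))
      (≡.trans (v-mult _ _) (≡.cong₂ _+∞_ (v-minEntry i j) (v-minEntry j l)))
      where
      product∈ : S (E (minEntry i j * minEntry j l) i l)
      product∈ = S-cong (E-· _ _ i j l) (S-· (E-minEntry∈ i j) (E-minEntry∈ j l))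

    ν-diagonal : ∀ i → ν i i ≡ + 0
    ν-diagonal i = ℤP.≤-antisym (≤ᵥ⇒≤ (≤ᵥ-cong (diag-diagonal _ i) (∈⇒ν≤ᵥ S-1 i i)) v-1)
      (≡.subst (ℤ._≤ ν i i) (ℤP.+-inverseʳ (ν i i)) (i≤j+k⇒i-k≤j (ν-triangle i i i)))

proposition3p10 :
    ∀ {c ℓ ℓS} (K : NALocalField c ℓ) (π : Carrier K) → IsUniformizer K π →
    (n : ℕ) (S : Mat K (suc n) → Set ℓS) → IsOrder K (suc n) S →
    (γ γ⁻¹ : Mat K (suc n)) →
    _≈ᴹ_ K (_·ᴹ_ K γ γ⁻¹) (1ᴹ K) → _≈ᴹ_ K (_·ᴹ_ K γ⁻¹ γ) (1ᴹ K) →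
    (∀ (d : Vec K (suc n)) → (∀ i → In𝒪 K (d i)) →
       S (_·ᴹ_ K (_·ᴹ_ K γ (diag K d)) γ⁻¹)) →
    ∃[ ν ] (Reduced {n} ν ×
      (∀ A → (S A → ∀ m → InCℤ ν m → InEnd K π γ m A) ×
             ((∀ m → InCℤ ν m → InEnd K π γ m A) → S A)))
proposition3p10 K π π-uniformizer n S O γ γ⁻¹ γγ⁻¹≈1 γ⁻¹γ≈1 γRγ⁻¹⊆S =
  ν , reduced , λ A → stable A , ∈S A
  where
  open ValuedField K
  open Lattices π π-uniformizer
  open DiagonalOrder (IsOrder-conjugate γ γ⁻¹ γγ⁻¹≈1 γ⁻¹γ≈1 O) γRγ⁻¹⊆S
  open QuasiMetricPolytope ν ν-diagonal ν-triangle
  open IsOrder O using (S-cong)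

  stable : ∀ A → S A → ∀ m → InCℤ ν m → InEnd K π γ m A
  stable A A∈S m (_ , m-bounds) = ≤ᵥ-entries⇒InEnd γ γ⁻¹ m A γγ⁻¹≈1 λ i k →
    ≤ᵥ-weaken (proj₂ (m-bounds i k))
      (∈⇒ν≤ᵥ {sandwich γ⁻¹ γ A} (S-cong (Mˢ.sym (sandwich-inverse γ γ⁻¹ γγ⁻¹≈1 A)) A∈S) i k)

  ∈S : ∀ A → (∀ m → InCℤ ν m → InEnd K π γ m A) → S A
  ∈S A A-stable = S-cong (sandwich-inverse γ γ⁻¹ γγ⁻¹≈1 A) (ν≤ᵥ⇒∈ λ i j →
    ≡.subst (_≤ᵥ sandwich γ⁻¹ γ A i j) (column-diff i j)
      (InEnd⇒≤ᵥ-entries γ γ⁻¹ (column j) A γ⁻¹γ≈1 (A-stable (column j) (column∈C j)) i j))
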